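{- Let $p$ be a prime and let $n=p^k$ for some positive integer $k$. Then the set $\mathcal{A}_n$ is empty.
   Context: For a positive integer $n$, $\Phi_n(x)$ denotes the $n$-th cyclotomic polynomial and $\mathcal{A}_n$ is the set of polynomials $f(x)\in\mathbb{Z}[x]$ such that $\Phi_n(x)$ divides $f(x)$ and $f(x)=x^m-a_{m-1}x^{m-1}-\cdots-a_1x-1$ for some integer $m<n$ with $a_i\in\{0,1\}$ for $1\le i<m$. -}

module Defs where

open import Data.Nat using (ℕ; zero; suc; _≤_; _<_)
open import Data.Nat.Divisibility using (_∣?_)
open import Data.Integer using (ℤ; +_; -_; -1ℤ; 0ℤ; 1ℤ) renaming (_+_ to _+ℤ_; _*_ to _*ℤ_)
open import Data.Bool using (Bool; true; false)
open import Data.List using (List; []; _∷_; _++_; [_]; map; foldr; upTo; filter; replicate)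
open import Data.Product using (Σ; ∃; _×_)
open import Relation.Binary.PropositionalEquality using (_≡_)

-- Polynomials in ℤ[x] as little-endian coefficient lists
-- (the list c₀ ∷ c₁ ∷ … represents c₀ + c₁ x + …).
Poly : Set
Poly = List ℤ

coeff : Poly → ℕ → ℤ
coeff []      _       = 0ℤ
coeff (c ∷ p) zero    = c
coeff (c ∷ p) (suc i) = coeff p i

-- equality of polynomials: equal coefficients (trailing zeros irrelevant)
infix 4 _≈P_
_≈P_ : Poly → Poly → Set
p ≈P q = ∀ i → coeff p i ≡ coeff q i

infixl 6 _+P_
_+P_ : Poly → Poly → Poly
[]      +P q       = q
(a ∷ p) +P []      = a ∷ p
(a ∷ p) +P (b ∷ q) = (a +ℤ b) ∷ (p +P q)

scaleP : ℤ → Poly → Poly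
scaleP c p = map (c *ℤ_) p

infixl 7 _*P_
_*P_ : Poly → Poly → Poly
[]      *P q = []
(a ∷ p) *P q = scaleP a q +P (0ℤ ∷ (p *P q))

X^ : ℕ → Poly
X^ n = replicate n 0ℤ ++ [ 1ℤ ]

prodP : List Poly → Poly
prodP = foldr _*P_ [ 1ℤ ]

divisors : ℕ → List ℕ
divisors n = filter (λ d → d ∣? n) (map suc (upTo n))

infix 4 _∣P_
_∣P_ : Poly → Poly → Set
d ∣P f = ∃ λ g → d *P g ≈P f

-- Φ is the family of cyclotomic polynomials: the defining identity
-- x^n - 1 = ∏_{d ∣ n} Φ_d for every n ≥ 1 (this determines Φ_n uniquely in ℤ[x]).
IsCyclotomic : (ℕ → Poly) → Set
IsCyclotomic Φ = ∀ n → 1 ≤ n → prodP (map Φ (divisors n)) ≈P (X^ n +P [ -1ℤ ])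

bℤ : Bool → ℤ
bℤ true  = 1ℤ
bℤ false = 0ℤ

-- f(x) = x^m - a_{m-1} x^{m-1} - … - a_1 x - 1, for m ≥ 1 (the m = 0 clause is unused)
fA : ℕ → (ℕ → Bool) → Poly
fA zero     a = []
fA (suc m') a = -1ℤ ∷ (map (λ i → - bℤ (a (suc i))) (upTo m') ++ [ 1ℤ ])

𝒜 : (ℕ → Poly) → ℕ → Poly → Set
𝒜 Φ n f = Σ ℕ λ m → 1 ≤ m × m < n × (Σ (ℕ → Bool) λ a → (f ≈P fA m a)) × (Φ n ∣P f)

{-# OPTIONS --safe #-}
-- With q = p^k and n = p^(k+1), the divisors of n are those of q together with n, so the
-- defining identity of the cyclotomic polynomials gives (x^q − 1) Φ_n = x^n − 1. Hence
-- f = Φ_n g implies (x^q − 1) f = (x^n − 1) g. As deg f = m < n, comparing coefficients of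
-- index ≥ n makes the coefficients of g periodic with period n from index q on, so g has
-- degree < q; comparing coefficients of index < n then gives f_r = f_(q+r) whenever q + r < n.
-- This copies either f_0 = −1 onto f_q = 0 (if m < q) or the leading 1 onto f_(m−q) ∈ {0, −1}.
module Submission where

open import Defs
open import Data.Nat using (ℕ; _≤_; _^_)
open import Data.Nat.Primality using (Prime)
open import Relation.Nullary using (¬_)

open import Data.Nat using (zero; suc; _+_; _*_; _∸_; _<_; _<?_; z≤n; s≤s; NonZero; >-nonZero; nonTrivial⇒n>1)
open import Data.Nat.Properties
  using (≤-refl; ≤-reflexive; ≤-trans; <-≤-trans; <⇒≱; <-irrefl; ≮⇒≥; m≤n⇒m≤1+n; n≤1+n; n<1+n;
         +-monoʳ-≤; +-suc; +-comm; +-assoc; +-identityʳ; +-∸-assoc; m≤m+n; m≤n+m; m<n+m; m+[n∸m]≡n;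
         m≤m*n; *-comm; *-identityʳ; m^n≢0; m^n>0; ^-monoʳ-<)
open import Data.Nat.Divisibility using (_∣_; _∣?_; divides; ∣-refl; ∣⇒≤; ∣-trans; ∣1⇒≡1; n∣m*n; *-cancelʳ-∣; *-monoˡ-∣)
open import Data.Nat.Coprimality using (Coprime; coprime-divisor)
open import Data.Nat.Primality using (prime⇒irreducible; prime⇒nonZero; prime⇒nonTrivial)
open import Data.Integer using (ℤ; -_; _-_; -1ℤ; 0ℤ; 1ℤ) renaming (_+_ to _+ℤ_; _*_ to _*ℤ_)
import Data.Integer.Properties as ℤ
open import Data.Integer.Tactic.RingSolver using (solve-∀)
open import Data.Bool using (Bool; true; false)
open import Data.List using (List; []; _∷_; _++_; [_]; map; filter; upTo; applyUpTo; replicate; length)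
open import Data.List.Properties
  using (length-map; length-upTo; length-++; upTo-∷ʳ; map-upTo; map-++; ++-identityʳ; filter-++; filter-accept; filter-reject)
open import Data.Product using (_,_)
open import Data.Sum using (_⊎_; inj₁; inj₂)
open import Function using (_∘_)
open import Level using (0ℓ)
open import Relation.Nullary using (yes; no; contradiction)
open import Relation.Unary using (Pred; Decidable)
open import Relation.Binary.Bundles using (Setoid)
open import Relation.Binary.PropositionalEquality using (_≡_; _≢_; refl; sym; trans; cong; cong₂; subst; module ≡-Reasoning)
import Relation.Binary.Reasoning.Setoid as SetoidReasoning

-- Polynomial arithmetic on coefficient lists

≈P-refl : ∀ {p} → p ≈P p
≈P-refl _ = refl

≈P-sym : ∀ {p q} → p ≈P q → q ≈P p
≈P-sym p≈q i = sym (p≈q i)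

≈P-trans : ∀ {p q r} → p ≈P q → q ≈P r → p ≈P r
≈P-trans p≈q q≈r i = trans (p≈q i) (q≈r i)

≈P-setoid : Setoid 0ℓ 0ℓ
≈P-setoid = record
  { Carrier       = Poly
  ; _≈_           = _≈P_
  ; isEquivalence = record
      { refl  = λ {p} → ≈P-refl {p}
      ; sym   = λ {p} {q} → ≈P-sym {p} {q}
      ; trans = λ {p} {q} {r} → ≈P-trans {p} {q} {r}
      }
  }

∷-cong : ∀ {a b} p q → a ≡ b → p ≈P q → a ∷ p ≈P b ∷ q
∷-cong _ _ a≡b _   zero    = a≡b
∷-cong _ _ _   p≈q (suc i) = p≈q i

[0]≈P[] : 0ℤ ∷ [] ≈P []
[0]≈P[] zero    = refl
[0]≈P[] (suc i) = refl

coeff-+P : ∀ p q i → coeff (p +P q) i ≡ coeff p i +ℤ coeff q i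
coeff-+P []      q       i       = sym (ℤ.+-identityˡ _)
coeff-+P (a ∷ p) []      i       = sym (ℤ.+-identityʳ _)
coeff-+P (a ∷ p) (b ∷ q) zero    = refl
coeff-+P (a ∷ p) (b ∷ q) (suc i) = coeff-+P p q i

+P-cong : ∀ p p' q q' → p ≈P p' → q ≈P q' → p +P q ≈P p' +P q'
+P-cong p p' q q' p≈p' q≈q' i =
  trans (coeff-+P p q i) (trans (cong₂ _+ℤ_ (p≈p' i) (q≈q' i)) (sym (coeff-+P p' q' i)))

+P-identityʳ : ∀ p → p +P [] ≈P p
+P-identityʳ []      = λ _ → refl
+P-identityʳ (a ∷ p) = λ _ → refl

coeff-scaleP : ∀ c p i → coeff (scaleP c p) i ≡ c *ℤ coeff p i
coeff-scaleP c []      i       = sym (ℤ.*-zeroʳ c)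
coeff-scaleP c (a ∷ p) zero    = refl
coeff-scaleP c (a ∷ p) (suc i) = coeff-scaleP c p i

coeff-∷-*P : ∀ a p q i → coeff ((a ∷ p) *P q) i ≡ a *ℤ coeff q i +ℤ coeff (0ℤ ∷ p *P q) i
coeff-∷-*P a p q i = trans (coeff-+P (scaleP a q) _ i) (cong (_+ℤ _) (coeff-scaleP a q i))

∷-*P-cong : ∀ a b p p' q q' → a ≡ b → q ≈P q' → p *P q ≈P p' *P q' → (a ∷ p) *P q ≈P (b ∷ p') *P q'
∷-*P-cong a b p p' q q' a≡b q≈q' pq≈p'q' i = begin
  coeff ((a ∷ p) *P q) i                       ≡⟨ coeff-∷-*P a p q i ⟩
  a *ℤ coeff q i +ℤ coeff (0ℤ ∷ p *P q) i      ≡⟨ cong₂ _+ℤ_ (cong₂ _*ℤ_ a≡b (q≈q' i)) (∷-cong _ _ refl pq≈p'q' i) ⟩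
  b *ℤ coeff q' i +ℤ coeff (0ℤ ∷ p' *P q') i   ≡⟨ coeff-∷-*P b p' q' i ⟨
  coeff ((b ∷ p') *P q') i                     ∎
  where open ≡-Reasoning

0∷-*P : ∀ p q → (0ℤ ∷ p) *P q ≈P 0ℤ ∷ (p *P q)
0∷-*P p q i = trans (coeff-∷-*P 0ℤ p q i) (ℤ.+-identityˡ _)

*P-congʳ : ∀ p q q' → q ≈P q' → p *P q ≈P p *P q'
*P-congʳ []      q q' q≈q' = λ _ → refl
*P-congʳ (a ∷ p) q q' q≈q' = ∷-*P-cong a a p p q q' refl q≈q' (*P-congʳ p q q' q≈q')

*P-zeroˡ : ∀ p q → p ≈P [] → p *P q ≈P []
*P-zeroˡ []      q _   = λ _ → refl
*P-zeroˡ (a ∷ p) q p≈0 = begin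
  (a ∷ p) *P q   ≈⟨ ∷-*P-cong a 0ℤ p [] q q (p≈0 0) (≈P-refl {q}) (*P-zeroˡ p q (p≈0 ∘ suc)) ⟩
  (0ℤ ∷ []) *P q ≈⟨ 0∷-*P [] q ⟩
  0ℤ ∷ []        ≈⟨ [0]≈P[] ⟩
  []             ∎
  where open SetoidReasoning ≈P-setoid

*P-congˡ : ∀ p p' q → p ≈P p' → p *P q ≈P p' *P q
*P-congˡ []      []       q _    = λ _ → refl
*P-congˡ []      (b ∷ p') q p≈p' = ≈P-sym {(b ∷ p') *P q} {[]} (*P-zeroˡ (b ∷ p') q (≈P-sym {[]} {b ∷ p'} p≈p'))
*P-congˡ (a ∷ p) []       q p≈p' = *P-zeroˡ (a ∷ p) q p≈p'
*P-congˡ (a ∷ p) (b ∷ p') q p≈p' = ∷-*P-cong a b p p' q q (p≈p' 0) (≈P-refl {q}) (*P-congˡ p p' q (p≈p' ∘ suc))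

*P-identityˡ : ∀ p → [ 1ℤ ] *P p ≈P p
*P-identityˡ p i =
  trans (coeff-∷-*P 1ℤ [] p i) (trans (cong₂ _+ℤ_ (ℤ.*-identityˡ (coeff p i)) ([0]≈P[] i)) (ℤ.+-identityʳ (coeff p i)))

*P-identityʳ : ∀ p → p *P [ 1ℤ ] ≈P p
*P-identityʳ []      = λ _ → refl
*P-identityʳ (a ∷ p) = ∷-cong _ _ (trans (ℤ.+-identityʳ _) (ℤ.*-identityʳ a)) (*P-identityʳ p)

*P-scaleˡ : ∀ c p q → scaleP c p *P q ≈P scaleP c (p *P q)
*P-scaleˡ c []      q = λ _ → refl
*P-scaleˡ c (a ∷ p) q i = begin
  coeff ((c *ℤ a ∷ scaleP c p) *P q) i               ≡⟨ coeff-∷-*P (c *ℤ a) (scaleP c p) q i ⟩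
  c *ℤ a *ℤ x +ℤ coeff (0ℤ ∷ scaleP c p *P q) i      ≡⟨ cong (c *ℤ a *ℤ x +ℤ_) tail-scaled ⟩
  c *ℤ a *ℤ x +ℤ c *ℤ y                              ≡⟨ cong (_+ℤ c *ℤ y) (ℤ.*-assoc c a x) ⟩
  c *ℤ (a *ℤ x) +ℤ c *ℤ y                            ≡⟨ ℤ.*-distribˡ-+ c (a *ℤ x) y ⟨
  c *ℤ (a *ℤ x +ℤ y)                                 ≡⟨ cong (c *ℤ_) (coeff-∷-*P a p q i) ⟨
  c *ℤ coeff ((a ∷ p) *P q) i                        ≡⟨ coeff-scaleP c ((a ∷ p) *P q) i ⟨
  coeff (scaleP c ((a ∷ p) *P q)) i                  ∎
  where
  open ≡-Reasoning
  x y : ℤ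
  x = coeff q i
  y = coeff (0ℤ ∷ p *P q) i
  tail-scaled : coeff (0ℤ ∷ scaleP c p *P q) i ≡ c *ℤ y
  tail-scaled = trans (∷-cong _ _ (sym (ℤ.*-zeroʳ c)) (*P-scaleˡ c p q) i) (coeff-scaleP c (0ℤ ∷ p *P q) i)

*P-distribʳ : ∀ u v w → (u +P v) *P w ≈P u *P w +P v *P w
*P-distribʳ []      v       w = λ _ → refl
*P-distribʳ (a ∷ u) []      w = ≈P-sym {(a ∷ u) *P w +P []} {(a ∷ u) *P w} (+P-identityʳ ((a ∷ u) *P w))
*P-distribʳ (a ∷ u) (b ∷ v) w i = begin
  coeff (((a +ℤ b) ∷ (u +P v)) *P w) i
    ≡⟨ coeff-∷-*P (a +ℤ b) (u +P v) w i ⟩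
  (a +ℤ b) *ℤ x +ℤ coeff (0ℤ ∷ (u +P v) *P w) i
    ≡⟨ cong ((a +ℤ b) *ℤ x +ℤ_) (∷-cong _ _ refl (*P-distribʳ u v w) i) ⟩
  (a +ℤ b) *ℤ x +ℤ coeff ((0ℤ ∷ u *P w) +P (0ℤ ∷ v *P w)) i
    ≡⟨ cong ((a +ℤ b) *ℤ x +ℤ_) (coeff-+P (0ℤ ∷ u *P w) (0ℤ ∷ v *P w) i) ⟩
  (a +ℤ b) *ℤ x +ℤ (coeff (0ℤ ∷ u *P w) i +ℤ coeff (0ℤ ∷ v *P w) i)
    ≡⟨ rearrange a b x _ _ ⟩
  (a *ℤ x +ℤ coeff (0ℤ ∷ u *P w) i) +ℤ (b *ℤ x +ℤ coeff (0ℤ ∷ v *P w) i)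
    ≡⟨ cong₂ _+ℤ_ (coeff-∷-*P a u w i) (coeff-∷-*P b v w i) ⟨
  coeff ((a ∷ u) *P w) i +ℤ coeff ((b ∷ v) *P w) i
    ≡⟨ coeff-+P ((a ∷ u) *P w) ((b ∷ v) *P w) i ⟨
  coeff ((a ∷ u) *P w +P (b ∷ v) *P w) i
    ∎
  where
  open ≡-Reasoning
  x : ℤ
  x = coeff w i
  rearrange : ∀ a b x y z → (a +ℤ b) *ℤ x +ℤ (y +ℤ z) ≡ (a *ℤ x +ℤ y) +ℤ (b *ℤ x +ℤ z)
  rearrange = solve-∀

*P-assoc : ∀ p q r → (p *P q) *P r ≈P p *P (q *P r)
*P-assoc []      q r = λ _ → refl
*P-assoc (a ∷ p) q r = begin
  (scaleP a q +P (0ℤ ∷ p *P q)) *P r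
    ≈⟨ *P-distribʳ (scaleP a q) (0ℤ ∷ p *P q) r ⟩
  scaleP a q *P r +P (0ℤ ∷ p *P q) *P r
    ≈⟨ +P-cong (scaleP a q *P r) (scaleP a (q *P r)) ((0ℤ ∷ p *P q) *P r) (0ℤ ∷ (p *P q) *P r)
               (*P-scaleˡ a q r) (0∷-*P (p *P q) r) ⟩
  scaleP a (q *P r) +P (0ℤ ∷ (p *P q) *P r)
    ≈⟨ +P-cong (scaleP a (q *P r)) (scaleP a (q *P r)) (0ℤ ∷ (p *P q) *P r) (0ℤ ∷ p *P (q *P r))
               (≈P-refl {scaleP a (q *P r)}) (∷-cong ((p *P q) *P r) (p *P (q *P r)) refl (*P-assoc p q r)) ⟩
  scaleP a (q *P r) +P (0ℤ ∷ p *P (q *P r))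
    ∎
  where open SetoidReasoning ≈P-setoid

prodP-++ : ∀ ps qs → prodP (ps ++ qs) ≈P prodP ps *P prodP qs
prodP-++ []       qs = ≈P-sym {[ 1ℤ ] *P prodP qs} {prodP qs} (*P-identityˡ (prodP qs))
prodP-++ (p ∷ ps) qs = begin
  p *P prodP (ps ++ qs)         ≈⟨ *P-congʳ p _ _ (prodP-++ ps qs) ⟩
  p *P (prodP ps *P prodP qs)   ≈⟨ *P-assoc p (prodP ps) (prodP qs) ⟨
  (p *P prodP ps) *P prodP qs   ∎
  where open SetoidReasoning ≈P-setoid

coeff-beyond-length : ∀ p {i} → length p ≤ i → coeff p i ≡ 0ℤ
coeff-beyond-length []      _         = refl
coeff-beyond-length (a ∷ p) (s≤s len≤i) = coeff-beyond-length p len≤i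

coeff-++-length : ∀ xs ys j → coeff (xs ++ ys) (length xs + j) ≡ coeff ys j
coeff-++-length []       ys j = refl
coeff-++-length (x ∷ xs) ys j = coeff-++-length xs ys j

coeff-++ˡ : ∀ xs ys {j} → j < length xs → coeff (xs ++ ys) j ≡ coeff xs j
coeff-++ˡ (x ∷ xs) ys {zero}  _         = refl
coeff-++ˡ (x ∷ xs) ys {suc j} (s≤s j<) = coeff-++ˡ xs ys j<

coeff-applyUpTo : ∀ (h : ℕ → ℤ) t {j} → j < t → coeff (applyUpTo h t) j ≡ h j
coeff-applyUpTo h (suc t) {zero}  _         = refl
coeff-applyUpTo h (suc t) {suc j} (s≤s j<t) = coeff-applyUpTo (h ∘ suc) t j<t

shift : ℕ → Poly → Poly
shift s p = replicate s 0ℤ ++ p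

coeff-shift-+ : ∀ s p j → coeff (shift s p) (s + j) ≡ coeff p j
coeff-shift-+ zero    p j = refl
coeff-shift-+ (suc s) p j = coeff-shift-+ s p j

coeff-shift-≥ : ∀ s p {i} → s ≤ i → coeff (shift s p) i ≡ coeff p (i ∸ s)
coeff-shift-≥ s p s≤i = trans (cong (coeff (shift s p)) (sym (m+[n∸m]≡n s≤i))) (coeff-shift-+ s p _)

coeff-shift-< : ∀ s p {i} → i < s → coeff (shift s p) i ≡ 0ℤ
coeff-shift-< (suc s) p {zero}  _         = refl
coeff-shift-< (suc s) p {suc i} (s≤s i<s) = coeff-shift-< s p i<s

X^-*P : ∀ s p → X^ s *P p ≈P shift s p
X^-*P zero    p = *P-identityˡ p
X^-*P (suc s) p = ≈P-trans {X^ (suc s) *P p} {0ℤ ∷ X^ s *P p} {shift (suc s) p}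
                            (0∷-*P (X^ s) p) (∷-cong (X^ s *P p) (shift s p) refl (X^-*P s p))

coeff-[-1]-*P : ∀ p i → coeff ([ -1ℤ ] *P p) i ≡ - coeff p i
coeff-[-1]-*P p i = begin
  coeff ([ -1ℤ ] *P p) i                 ≡⟨ coeff-∷-*P -1ℤ [] p i ⟩
  -1ℤ *ℤ coeff p i +ℤ coeff (0ℤ ∷ []) i  ≡⟨ cong₂ _+ℤ_ (ℤ.-1*i≡-i (coeff p i)) ([0]≈P[] i) ⟩
  - coeff p i +ℤ 0ℤ                      ≡⟨ ℤ.+-identityʳ _ ⟩
  - coeff p i                            ∎
  where open ≡-Reasoning

coeff-[X^s-1]-*P : ∀ s p i → coeff ((X^ s +P [ -1ℤ ]) *P p) i ≡ coeff (shift s p) i - coeff p i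
coeff-[X^s-1]-*P s p i = begin
  coeff ((X^ s +P [ -1ℤ ]) *P p) i                   ≡⟨ *P-distribʳ (X^ s) [ -1ℤ ] p i ⟩
  coeff (X^ s *P p +P [ -1ℤ ] *P p) i                ≡⟨ coeff-+P (X^ s *P p) ([ -1ℤ ] *P p) i ⟩
  coeff (X^ s *P p) i +ℤ coeff ([ -1ℤ ] *P p) i      ≡⟨ cong₂ _+ℤ_ (X^-*P s p i) (coeff-[-1]-*P p i) ⟩
  coeff (shift s p) i - coeff p i                    ∎
  where open ≡-Reasoning

-- Divisors of prime powers

oneTo : ℕ → List ℕ
oneTo t = map suc (upTo t)

oneTo-suc : ∀ t → oneTo (suc t) ≡ oneTo t ++ [ suc t ]
oneTo-suc t = trans (cong (map suc) (sym (upTo-∷ʳ t))) (map-++ suc (upTo t) [ t ])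

module _ {P Q : Pred ℕ 0ℓ} (P? : Decidable P) (Q? : Decidable Q) where

  filter-[]-cong : ∀ x → (P x → Q x) → (Q x → P x) → filter P? [ x ] ≡ filter Q? [ x ]
  filter-[]-cong x P⇒Q Q⇒P with P? x | Q? x
  ... | yes _  | yes _  = refl
  ... | no  _  | no  _  = refl
  ... | yes Px | no ¬Qx = contradiction (P⇒Q Px) ¬Qx
  ... | no ¬Px | yes Qx = contradiction (Q⇒P Qx) ¬Px

  filter-oneTo-cong : ∀ t → (∀ {d} → d ≤ t → P d → Q d) → (∀ {d} → d ≤ t → Q d → P d) →
                      filter P? (oneTo t) ≡ filter Q? (oneTo t)
  filter-oneTo-cong zero    _   _   = refl
  filter-oneTo-cong (suc t) P⇒Q Q⇒P = begin
    filter P? (oneTo (suc t))                   ≡⟨ cong (filter P?) (oneTo-suc t) ⟩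
    filter P? (oneTo t ++ [ suc t ])            ≡⟨ filter-++ P? (oneTo t) [ suc t ] ⟩
    filter P? (oneTo t) ++ filter P? [ suc t ]  ≡⟨ cong₂ _++_ (filter-oneTo-cong t (P⇒Q ∘ m≤n⇒m≤1+n) (Q⇒P ∘ m≤n⇒m≤1+n))
                                                             (filter-[]-cong (suc t) (P⇒Q ≤-refl) (Q⇒P ≤-refl)) ⟩
    filter Q? (oneTo t) ++ filter Q? [ suc t ]  ≡⟨ filter-++ Q? (oneTo t) [ suc t ] ⟨
    filter Q? (oneTo t ++ [ suc t ])            ≡⟨ cong (filter Q?) (oneTo-suc t) ⟨
    filter Q? (oneTo (suc t))                   ∎
    where open ≡-Reasoning

filter-oneTo-+ : ∀ {P : Pred ℕ 0ℓ} (P? : Decidable P) t s → (∀ {d} → t < d → d ≤ t + s → ¬ P d) →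
                 filter P? (oneTo (t + s)) ≡ filter P? (oneTo t)
filter-oneTo-+ P? t zero    _  = cong (filter P? ∘ oneTo) (+-identityʳ t)
filter-oneTo-+ P? t (suc s) ¬P = begin
  filter P? (oneTo (t + suc s))                         ≡⟨ cong (filter P? ∘ oneTo) (+-suc t s) ⟩
  filter P? (oneTo (suc (t + s)))                       ≡⟨ cong (filter P?) (oneTo-suc (t + s)) ⟩
  filter P? (oneTo (t + s) ++ [ suc (t + s) ])          ≡⟨ filter-++ P? (oneTo (t + s)) [ suc (t + s) ] ⟩
  filter P? (oneTo (t + s)) ++ filter P? [ suc (t + s) ]
    ≡⟨ cong₂ _++_ (filter-oneTo-+ P? t s (λ t<d d≤t+s → ¬P t<d (≤-trans d≤t+s (+-monoʳ-≤ t (n≤1+n s)))))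
                  (filter-reject P? (¬P (s≤s (m≤m+n t s)) (≤-reflexive (sym (+-suc t s))))) ⟩
  filter P? (oneTo t) ++ []                             ≡⟨ ++-identityʳ _ ⟩
  filter P? (oneTo t)                                   ∎
  where open ≡-Reasoning

divisors-≡-++ : ∀ {q n} .{{_ : NonZero q}} → q < n → (∀ {d} → d ∣ q → d ∣ n) →
                (∀ {d} → d ∣ n → d ∣ q ⊎ d ≡ n) → divisors n ≡ divisors q ++ [ n ]
divisors-≡-++ {q} {n} q<n ∣q⇒∣n ∣n⇒∣q⊎≡n = begin
  filter (_∣? n) (oneTo n)                                ≡⟨ cong (filter (_∣? n)) oneTo-n ⟩
  filter (_∣? n) (oneTo (q + s) ++ [ n ])                 ≡⟨ filter-++ (_∣? n) (oneTo (q + s)) [ n ] ⟩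
  filter (_∣? n) (oneTo (q + s)) ++ filter (_∣? n) [ n ]  ≡⟨ cong₂ _++_ (filter-oneTo-+ (_∣? n) q s no-divisor-above-q)
                                                                        (filter-accept (_∣? n) ∣-refl) ⟩
  filter (_∣? n) (oneTo q) ++ [ n ]                       ≡⟨ cong (_++ [ n ])
                                                               (filter-oneTo-cong (_∣? n) (_∣? q) q ∣n⇒∣q (λ _ → ∣q⇒∣n)) ⟩
  filter (_∣? q) (oneTo q) ++ [ n ]                       ∎
  where
  open ≡-Reasoning
  s : ℕ
  s = n ∸ suc q
  1+q+s≡n : suc (q + s) ≡ n
  1+q+s≡n = m+[n∸m]≡n q<n
  oneTo-n : oneTo n ≡ oneTo (q + s) ++ [ n ]
  oneTo-n = trans (cong oneTo (sym 1+q+s≡n)) (trans (oneTo-suc (q + s)) (cong (λ x → oneTo (q + s) ++ [ x ]) 1+q+s≡n))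
  no-divisor-above-q : ∀ {d} → q < d → d ≤ q + s → ¬ d ∣ n
  no-divisor-above-q q<d d≤q+s d∣n with ∣n⇒∣q⊎≡n d∣n
  ... | inj₁ d∣q = <⇒≱ q<d (∣⇒≤ d∣q)
  ... | inj₂ d≡n = <-irrefl refl (subst (_≤ q + s) (trans d≡n (sym 1+q+s≡n)) d≤q+s)
  ∣n⇒∣q : ∀ {d} → d ≤ q → d ∣ n → d ∣ q
  ∣n⇒∣q d≤q d∣n with ∣n⇒∣q⊎≡n d∣n
  ... | inj₁ d∣q = d∣q
  ... | inj₂ refl = contradiction d≤q (<⇒≱ q<n)

∣p^[1+k]⇒∣p^k⊎≡p^[1+k] : ∀ {p d} → Prime p → ∀ k → d ∣ p ^ suc k → d ∣ p ^ k ⊎ d ≡ p ^ suc k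
∣p^[1+k]⇒∣p^k⊎≡p^[1+k] {p} {d} pp k d∣p^[1+k] with p ∣? d
... | no p∤d = inj₁ (coprime-divisor d⊥p d∣p^[1+k])
  where
  d⊥p : Coprime d p
  d⊥p (i∣d , i∣p) with prime⇒irreducible pp i∣p
  ... | inj₁ i≡1  = i≡1
  ... | inj₂ refl = contradiction i∣d p∤d
... | yes (divides e refl) = lift k e∣p^k
  where
  instance _ = prime⇒nonZero pp
  e∣p^k : e ∣ p ^ k
  e∣p^k = *-cancelʳ-∣ p (subst (e * p ∣_) (*-comm p (p ^ k)) d∣p^[1+k])
  lift : ∀ j → e ∣ p ^ j → e * p ∣ p ^ j ⊎ e * p ≡ p ^ suc j
  lift zero    e∣1 rewrite ∣1⇒≡1 e∣1 = inj₂ (trans (+-identityʳ p) (sym (*-identityʳ p)))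
  lift (suc j) e∣p^[1+j] with ∣p^[1+k]⇒∣p^k⊎≡p^[1+k] pp j e∣p^[1+j]
  ... | inj₁ e∣p^j = inj₁ (subst (e * p ∣_) (*-comm (p ^ j) p) (*-monoˡ-∣ p e∣p^j))
  ... | inj₂ refl  = inj₂ (*-comm (p ^ suc j) p)

p^k<p^[1+k] : ∀ {p} → Prime p → ∀ k → p ^ k < p ^ suc k
p^k<p^[1+k] {p} pp k = ^-monoʳ-< p (nonTrivial⇒n>1 p {{prime⇒nonTrivial pp}}) (n<1+n k)

divisors-prime-power : ∀ {p} → Prime p → ∀ k → divisors (p ^ suc k) ≡ divisors (p ^ k) ++ [ p ^ suc k ]
divisors-prime-power {p} pp k =
  divisors-≡-++ (p^k<p^[1+k] pp k) (λ d∣p^k → ∣-trans d∣p^k (n∣m*n p)) (∣p^[1+k]⇒∣p^k⊎≡p^[1+k] pp k)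
  where
  instance _ = prime⇒nonZero pp
  instance _ = m^n≢0 p k

module _ {Φ : ℕ → Poly} (cyclotomic : IsCyclotomic Φ) where

  [X^q-1]*Φn≈X^n-1 : ∀ {q n} → 1 ≤ q → 1 ≤ n → divisors n ≡ divisors q ++ [ n ] →
                     (X^ q +P [ -1ℤ ]) *P Φ n ≈P X^ n +P [ -1ℤ ]
  [X^q-1]*Φn≈X^n-1 {q} {n} 1≤q 1≤n divisors-n = begin
    (X^ q +P [ -1ℤ ]) *P Φ n                     ≈⟨ *P-congˡ (X^ q +P [ -1ℤ ]) Φ[q] (Φ n)
                                                               (≈P-sym {Φ[q]} {X^ q +P [ -1ℤ ]} (cyclotomic q 1≤q)) ⟩
    Φ[q] *P Φ n                                  ≈⟨ *P-congʳ Φ[q] (Φ n) (prodP [ Φ n ])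
                                                               (≈P-sym {prodP [ Φ n ]} {Φ n} (*P-identityʳ (Φ n))) ⟩
    Φ[q] *P prodP [ Φ n ]                        ≈⟨ prodP-++ (map Φ (divisors q)) [ Φ n ] ⟨
    prodP (map Φ (divisors q) ++ [ Φ n ])        ≡⟨ cong prodP (trans (cong (map Φ) divisors-n)
                                                                      (map-++ Φ (divisors q) [ n ])) ⟨
    prodP (map Φ (divisors n))                   ≈⟨ cyclotomic n 1≤n ⟩
    X^ n +P [ -1ℤ ]                              ∎
    where
    open SetoidReasoning ≈P-setoid
    Φ[q] : Poly
    Φ[q] = prodP (map Φ (divisors q))

  [X^q-1]*f≈[X^n-1]*g : ∀ {p f g} → Prime p → ∀ k → Φ (p ^ suc k) *P g ≈P f →
                        (X^ (p ^ k) +P [ -1ℤ ]) *P f ≈P (X^ (p ^ suc k) +P [ -1ℤ ]) *P g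
  [X^q-1]*f≈[X^n-1]*g {p} {f} {g} pp k Φg≈f = begin
    (X^ q +P [ -1ℤ ]) *P f               ≈⟨ *P-congʳ (X^ q +P [ -1ℤ ]) f (Φ n *P g) (≈P-sym {Φ n *P g} {f} Φg≈f) ⟩
    (X^ q +P [ -1ℤ ]) *P (Φ n *P g)      ≈⟨ *P-assoc (X^ q +P [ -1ℤ ]) (Φ n) g ⟨
    ((X^ q +P [ -1ℤ ]) *P Φ n) *P g      ≈⟨ *P-congˡ ((X^ q +P [ -1ℤ ]) *P Φ n) (X^ n +P [ -1ℤ ]) g
                                                     ([X^q-1]*Φn≈X^n-1 (m^n>0 p k) (m^n>0 p (suc k))
                                                                       (divisors-prime-power pp k)) ⟩
    (X^ n +P [ -1ℤ ]) *P g               ∎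
    where
    open SetoidReasoning ≈P-setoid
    instance _ = prime⇒nonZero pp
    q n : ℕ
    q = p ^ k
    n = p ^ suc k

  shift-identity-prime-power : ∀ {p f g} → Prime p → ∀ k → Φ (p ^ suc k) *P g ≈P f →
    ∀ i → coeff (shift (p ^ k) f) i - coeff f i ≡ coeff (shift (p ^ suc k) g) i - coeff g i
  shift-identity-prime-power {p} {f} {g} pp k Φg≈f i = begin
    coeff (shift (p ^ k) f) i - coeff f i                ≡⟨ coeff-[X^s-1]-*P (p ^ k) f i ⟨
    coeff ((X^ (p ^ k) +P [ -1ℤ ]) *P f) i               ≡⟨ [X^q-1]*f≈[X^n-1]*g pp k Φg≈f i ⟩
    coeff ((X^ (p ^ suc k) +P [ -1ℤ ]) *P g) i           ≡⟨ coeff-[X^s-1]-*P (p ^ suc k) g i ⟩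
    coeff (shift (p ^ suc k) g) i - coeff g i            ∎
    where open ≡-Reasoning

-- Comparing coefficients in (x^q − 1) f = (x^n − 1) g

module ShiftIdentity {q n m : ℕ} {f g : Poly} (m<n : m < n)
  (f-vanishes : ∀ {i} → m < i → coeff f i ≡ 0ℤ)
  (shift-identity : ∀ i → coeff (shift q f) i - coeff f i ≡ coeff (shift n g) i - coeff g i) where

  g-periodic : ∀ {j} → q ≤ j → coeff g j ≡ coeff g (n + j)
  g-periodic {j} q≤j = ℤ.i-j≡0⇒i≡j _ _ (begin
    coeff g j - coeff g (n + j)                  ≡⟨ cong (_- coeff g (n + j)) (coeff-shift-+ n g j) ⟨
    coeff (shift n g) (n + j) - coeff g (n + j)  ≡⟨ shift-identity (n + j) ⟨
    coeff (shift q f) (n + j) - coeff f (n + j)  ≡⟨ cong₂ _-_ shifted-f-vanishes (f-vanishes (<-≤-trans m<n (m≤m+n n j))) ⟩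
    0ℤ                                           ∎)
    where
    open ≡-Reasoning
    m<n+j-q : m < n + j ∸ q
    m<n+j-q = <-≤-trans m<n (≤-trans (m≤m+n n (j ∸ q)) (≤-reflexive (sym (+-∸-assoc n q≤j))))
    shifted-f-vanishes : coeff (shift q f) (n + j) ≡ 0ℤ
    shifted-f-vanishes = trans (coeff-shift-≥ q f (≤-trans q≤j (m≤n+m j n))) (f-vanishes m<n+j-q)

  g-periodic-iterate : ∀ t {j} → q ≤ j → coeff g j ≡ coeff g (t * n + j)
  g-periodic-iterate zero    q≤j = refl
  g-periodic-iterate (suc t) {j} q≤j = begin
    coeff g j                  ≡⟨ g-periodic-iterate t q≤j ⟩
    coeff g (t * n + j)        ≡⟨ g-periodic (≤-trans q≤j (m≤n+m j (t * n))) ⟩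
    coeff g (n + (t * n + j))  ≡⟨ cong (coeff g) (+-assoc n (t * n) j) ⟨
    coeff g (n + t * n + j)    ∎
    where open ≡-Reasoning

  -- Periodicity carries every coefficient of index ≥ q beyond the end of the list g.
  g-vanishes : ∀ {j} → q ≤ j → coeff g j ≡ 0ℤ
  g-vanishes {j} q≤j = trans (g-periodic-iterate (length g) q≤j) (coeff-beyond-length g len≤)
    where
    instance _ = >-nonZero (<-≤-trans (s≤s z≤n) m<n)
    len≤ : length g ≤ length g * n + j
    len≤ = ≤-trans (m≤m*n (length g) n) (m≤m+n _ j)

  f-periodic : ∀ {r} → q + r < n → coeff f r ≡ coeff f (q + r)
  f-periodic {r} q+r<n = ℤ.i-j≡0⇒i≡j _ _ (begin
    coeff f r - coeff f (q + r)                  ≡⟨ cong (_- coeff f (q + r)) (coeff-shift-+ q f r) ⟨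
    coeff (shift q f) (q + r) - coeff f (q + r)  ≡⟨ shift-identity (q + r) ⟩
    coeff (shift n g) (q + r) - coeff g (q + r)  ≡⟨ cong₂ _-_ (coeff-shift-< n g q+r<n) (g-vanishes (m≤m+n q r)) ⟩
    0ℤ                                           ∎)
    where open ≡-Reasoning

module _ (m' : ℕ) (a : ℕ → Bool) where

  private
    middle : Poly
    middle = map (λ i → - bℤ (a (suc i))) (upTo m')

    length-middle : length middle ≡ m'
    length-middle = trans (length-map _ (upTo m')) (length-upTo m')

  length-fA : length (fA (suc m') a) ≡ suc (suc m')
  length-fA = cong suc (trans (length-++ middle) (trans (+-comm (length middle) 1) (cong suc length-middle)))

  fA-coeff-top : coeff (fA (suc m') a) (suc m') ≡ 1ℤ
  fA-coeff-top = trans (cong (coeff (middle ++ [ 1ℤ ])) (trans (sym length-middle) (sym (+-identityʳ _))))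
                       (coeff-++-length middle [ 1ℤ ] 0)

  fA-coeff-above : ∀ {i} → suc m' < i → coeff (fA (suc m') a) i ≡ 0ℤ
  fA-coeff-above m<i = coeff-beyond-length (fA (suc m') a) (≤-trans (≤-reflexive length-fA) m<i)

  fA-coeff-middle : ∀ {j} → j < m' → coeff (fA (suc m') a) (suc j) ≡ - bℤ (a (suc j))
  fA-coeff-middle {j} j<m' = begin
    coeff (middle ++ [ 1ℤ ]) j                           ≡⟨ coeff-++ˡ middle [ 1ℤ ] (subst (j <_) (sym length-middle) j<m') ⟩
    coeff middle j                                       ≡⟨ cong (λ xs → coeff xs j) (map-upTo _ m') ⟩
    coeff (applyUpTo (λ i → - bℤ (a (suc i))) m') j      ≡⟨ coeff-applyUpTo _ m' j<m' ⟩
    - bℤ (a (suc j))                                     ∎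
    where open ≡-Reasoning

  fA-coeff-below-≢1 : ∀ {i} → i < suc m' → coeff (fA (suc m') a) i ≢ 1ℤ
  fA-coeff-below-≢1 {zero}  _         ()
  fA-coeff-below-≢1 {suc j} (s≤s j<m') = -bℤ≢1 (a (suc j)) ∘ trans (sym (fA-coeff-middle j<m'))
    where
    -bℤ≢1 : ∀ b → - bℤ b ≢ 1ℤ
    -bℤ≢1 true  ()
    -bℤ≢1 false ()

  fA-aperiodic : ∀ {q n} → 0 < q → q < n → suc m' < n →
                 ¬ (∀ {r} → q + r < n → coeff (fA (suc m') a) r ≡ coeff (fA (suc m') a) (q + r))
  fA-aperiodic {q} {n} 0<q q<n m<n periodic with suc m' <? q
  ... | yes m<q = -1≢0 (trans (periodic (subst (_< n) (sym (+-identityʳ q)) q<n))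
                              (fA-coeff-above (subst (suc m' <_) (sym (+-identityʳ q)) m<q)))
    where
    -1≢0 : -1ℤ ≢ 0ℤ
    -1≢0 ()
  ... | no m≮q = fA-coeff-below-≢1 (subst (r <_) q+r≡m (m<n+m r 0<q))
                   (trans (periodic (subst (_< n) (sym q+r≡m) m<n)) (trans (cong (coeff (fA (suc m') a)) q+r≡m) fA-coeff-top))
    where
    r : ℕ
    r = suc m' ∸ q
    q+r≡m : q + r ≡ suc m'
    q+r≡m = m+[n∸m]≡n (≮⇒≥ m≮q)

lemma3p6 : (Φ : ℕ → Poly) → IsCyclotomic Φ →
           (p k : ℕ) → Prime p → 1 ≤ k →
           (f : Poly) → ¬ 𝒜 Φ (p ^ k) f
lemma3p6 Φ cyclotomic p (suc k) pp _ f (suc m' , _ , m<n , (a , f≈fA) , (g , Φg≈f)) =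
  fA-aperiodic m' a (m^n>0 p k) (p^k<p^[1+k] pp k) m<n fA-periodic
  where
  instance _ = prime⇒nonZero pp
  f-periodic : ∀ {r} → p ^ k + r < p ^ suc k → coeff f r ≡ coeff f (p ^ k + r)
  f-periodic = ShiftIdentity.f-periodic {p ^ k} {p ^ suc k} {suc m'} {f} {g} m<n
                 (λ {i} m<i → trans (f≈fA i) (fA-coeff-above m' a m<i))
                 (shift-identity-prime-power cyclotomic pp k Φg≈f)
  fA-periodic : ∀ {r} → p ^ k + r < p ^ suc k → coeff (fA (suc m') a) r ≡ coeff (fA (suc m') a) (p ^ k + r)
  fA-periodic {r} q+r<n = trans (sym (f≈fA r)) (trans (f-periodic q+r<n) (f≈fA (p ^ k + r)))
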